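{- If there exists a $3$-GDD of type $w^u$ whose weak chromatic number equals $2$, then $u\in\{3,4\}$.
   Context: A group divisible design (GDD) is a triple $(V,{\cal G},{\cal B})$ where ${\cal G}$ partitions the point set $V$ into groups and ${\cal B}$ is a collection of subsets (blocks) such that every pair of distinct points lies either in exactly one block or in exactly one group, but not both. A $3$-GDD of type $w^u$ has all blocks of size $3$ and $u$ groups each of size $w$. A weak $c$-colouring is a map from the points to a set of $c$ colours such that no block is monochromatic (i.e., every block contains two points of different colours). The (weak) chromatic number is the least $c$ such that a weak $c$-colouring exists. -}

module Defs where

open import Data.Nat using (ℕ; _<_)
open import Data.Fin using (Fin)
open import Data.Product using (_×_; _,_; proj₁; Σ-syntax)
open import Data.Sum using (_⊎_)
open import Data.List using (List; length; lookup)
open import Data.List.Relation.Unary.All using (All)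
open import Relation.Binary.PropositionalEquality using (_≡_; _≢_)
open import Relation.Nullary using (¬_)

-- Points of a GDD of type w^u: without loss of generality the point set is
-- Fin u × Fin w, and the i-th group is { (i , j) | j : Fin w }.
Point : ℕ → ℕ → Set
Point u w = Fin u × Fin w

group : ∀ {u w} → Point u w → Fin u
group = proj₁

Block : ℕ → ℕ → Set
Block u w = Point u w × Point u w × Point u w

_∈B_ : ∀ {u w} → Point u w → Block u w → Set
x ∈B (a , b , c) = x ≡ a ⊎ x ≡ b ⊎ x ≡ c

DistinctBlock : ∀ {u w} → Block u w → Set
DistinctBlock (a , b , c) = a ≢ b × a ≢ c × b ≢ c

record GDD3 (u w : ℕ) : Set where
  field
    blocks   : List (Block u w)
    size3    : All DistinctBlock blocks
    inGroup  : (x y : Point u w) → x ≢ y → group x ≡ group y →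
               (i : Fin (length blocks)) →
               ¬ (x ∈B lookup blocks i × y ∈B lookup blocks i)
    outGroup : (x y : Point u w) → group x ≢ group y →
               Σ[ i ∈ Fin (length blocks) ]
                 ((x ∈B lookup blocks i × y ∈B lookup blocks i) ×
                  ((j : Fin (length blocks)) →
                     x ∈B lookup blocks j × y ∈B lookup blocks j → j ≡ i))

open GDD3 public

Monochromatic : ∀ {u w c} → (Point u w → Fin c) → Block u w → Set
Monochromatic f (a , b , d) = f a ≡ f b × f b ≡ f d

WeakColouring : ∀ {u w} → GDD3 u w → (c : ℕ) → (Point u w → Fin c) → Set
WeakColouring D c f = All (λ B → ¬ Monochromatic f B) (blocks D)

WeakColourable : ∀ {u w} → GDD3 u w → ℕ → Set
WeakColourable {u} {w} D c = Σ[ f ∈ (Point u w → Fin c) ] WeakColouring D c f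

WeakChromaticNumber : ∀ {u w} → GDD3 u w → ℕ → Set
WeakChromaticNumber D c = WeakColourable D c × ((c' : ℕ) → c' < c → ¬ WeakColourable D c')

-- A weak 2-colouring splits the uw points into colour classes of sizes r and b.
-- A non-monochromatic block contains one monochromatic and two bichromatic pairs,
-- and two points in different groups lie in exactly one block, so among ordered
-- cross-group pairs the bichromatic ones are exactly twice the monochromatic ones.
-- Among all (uw)² ordered pairs the bichromatic ones, 2rb, are at most the
-- monochromatic ones, r² + b², and only uw² pairs lie inside a group; together
-- this gives (uw)² ≤ 4uw², hence u ≤ 4. Chromatic number 2 forces a block, whose
-- three points lie in three different groups, hence u ≥ 3.
module Submission where

open import Defs
open import Data.Bool.Base using (if_then_else_)
open import Data.Empty using (⊥-elim)
open import Data.Fin.Base using (Fin; zero; suc)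
open import Data.Fin.Patterns using (0F; 1F)
open import Data.Fin.Properties using (_≟_; suc-injective; nonZeroIndex)
open import Data.List.Base using ([]; _∷_; length; lookup)
open import Data.List.Membership.Propositional.Properties using (∈-lookup)
open import Data.List.Relation.Unary.All as All using ([])
open import Data.Nat.Base using (ℕ; zero; suc; _+_; _*_; _≤_; z≤n; s≤s; NonZero)
open import Data.Nat.Properties
  using ( +-*-semiring; *-identityˡ; *-identityʳ; *-zeroʳ; *-assoc; *-distribʳ-+; *-distribˡ-+; +-identityʳ; +-comm
        ; ≤-total; ≤-trans; m≤m+n; m≤n⇒∃[o]m+o≡n; +-cancelˡ-≤; *-cancelʳ-≤; +-monoˡ-≤; *-monoʳ-≤; m*n≢0
        ; module ≤-Reasoning)
open import Algebra.Properties.Semiring.Sum +-*-semiring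
  using (sum-syntax; sum-cong-≗; sum-replicate-zero; ∑-distrib-+; ∑-comm; *-distribˡ-sum; *-distribʳ-sum)
open import Data.Nat.Tactic.RingSolver using (solve-∀)
open import Data.Product.Base using (_×_; _,_; proj₁; proj₂)
open import Data.Product.Properties using (≡-dec)
open import Data.Sum.Base using (_⊎_; inj₁; inj₂)
open import Function.Base using (_∘_)
open import Relation.Binary.Definitions using (DecidableEquality)
open import Relation.Binary.PropositionalEquality
open import Relation.Nullary using (¬_; Dec; yes; no; does; ¬?; _⊎-dec_)

-- Defined through `does` so that it computes on decisions built with `map′`,
-- such as `_≟_` on `Fin`.
𝟙 : ∀ {a} {A : Set a} → Dec A → ℕ
𝟙 d = if does d then 1 else 0

𝟙-yes : ∀ {a} {A : Set a} (d : Dec A) → A → 𝟙 d ≡ 1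
𝟙-yes (yes _) _  = refl
𝟙-yes (no ¬a) a  = ⊥-elim (¬a a)

𝟙-no : ∀ {a} {A : Set a} (d : Dec A) → ¬ A → 𝟙 d ≡ 0
𝟙-no (yes a) ¬a = ⊥-elim (¬a a)
𝟙-no (no _)  _  = refl

𝟙-¬?+𝟙 : ∀ {a} {A : Set a} (d : Dec A) → 𝟙 (¬? d) + 𝟙 d ≡ 1
𝟙-¬?+𝟙 (yes _) = refl
𝟙-¬?+𝟙 (no _)  = refl

∑-zero : ∀ n {f : Fin n → ℕ} → (∀ i → f i ≡ 0) → ∑[ i < n ] f i ≡ 0
∑-zero n f≡0 = trans (sum-cong-≗ f≡0) (sum-replicate-zero n)

∑-const : ∀ n c → ∑[ i < n ] c ≡ n * c
∑-const zero    c = refl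
∑-const (suc n) c = cong (c +_) (∑-const n c)

∑-single : ∀ {n} {f : Fin n → ℕ} (k : Fin n) → (∀ i → i ≢ k → f i ≡ 0) → ∑[ i < n ] f i ≡ f k
∑-single {suc n} {f} zero f≡0 =
  trans (cong (f zero +_) (∑-zero n (λ i → f≡0 (suc i) λ ()))) (+-identityʳ (f zero))
∑-single {suc n} {f} (suc k) f≡0 =
  cong₂ _+_ (f≡0 zero λ ()) (∑-single k (λ i i≢k → f≡0 (suc i) (i≢k ∘ suc-injective)))

m≤n⇒m*n+n*m≤m*m+n*n : ∀ {m n} → m ≤ n → m * n + n * m ≤ m * m + n * n
m≤n⇒m*n+n*m≤m*m+n*n {m} m≤n with m≤n⇒∃[o]m+o≡n m≤n
... | d , refl = subst (m * (m + d) + (m + d) * m ≤_) (squares m d) (m≤m+n _ (d * d))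
  where
  squares : ∀ m d → m * (m + d) + (m + d) * m + d * d ≡ m * m + (m + d) * (m + d)
  squares = solve-∀

m*n+n*m≤m*m+n*n : ∀ m n → m * n + n * m ≤ m * m + n * n
m*n+n*m≤m*m+n*n m n with ≤-total m n
... | inj₁ m≤n = m≤n⇒m*n+n*m≤m*m+n*n m≤n
... | inj₂ n≤m = subst₂ _≤_ (+-comm (n * m) (m * n)) (+-comm (n * n) (m * m)) (m≤n⇒m*n+n*m≤m*m+n*n n≤m)

pair-count-bound : ∀ c s s′ → 2 * c + s′ ≤ c + s → (c + s) + (2 * c + s′) ≤ 4 * (s + s′)
pair-count-bound c s s′ 2c+s′≤c+s = begin
  (c + s) + (2 * c + s′)     ≡⟨ regroup c s s′ ⟩
  3 * c + (s + s′)           ≤⟨ +-monoˡ-≤ (s + s′) (*-monoʳ-≤ 3 c≤s+s′) ⟩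
  3 * (s + s′) + (s + s′)    ≡⟨ +-comm (3 * (s + s′)) (s + s′) ⟩
  4 * (s + s′)               ∎
  where
  open ≤-Reasoning
  regroup : ∀ c s s′ → (c + s) + (2 * c + s′) ≡ 3 * c + (s + s′)
  regroup = solve-∀
  unfold-2* : ∀ c s′ → 2 * c + s′ ≡ c + (c + s′)
  unfold-2* = solve-∀
  c+s′≤s : c + s′ ≤ s
  c+s′≤s = +-cancelˡ-≤ c (c + s′) s (subst (_≤ c + s) (unfold-2* c s′) 2c+s′≤c+s)
  c≤s+s′ : c ≤ s + s′
  c≤s+s′ = ≤-trans (m≤m+n c s′) (≤-trans c+s′≤s (m≤m+n s s′))

u²w²≤4uw²⇒u≤4 : ∀ u w .{{_ : NonZero w}} → (u * w) * (u * w) ≤ 4 * (u * (w * w)) → u ≤ 4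
u²w²≤4uw²⇒u≤4 zero    w _ = z≤n
u²w²≤4uw²⇒u≤4 (suc u) w h =
  *-cancelʳ-≤ (suc u) 4 (suc u)
    (*-cancelʳ-≤ (suc u * suc u) (4 * suc u) (w * w) {{m*n≢0 w w}}
      (subst₂ _≤_ (lhs (suc u) w) (rhs (suc u) w) h))
  where
  lhs : ∀ u w → (u * w) * (u * w) ≡ u * u * (w * w)
  lhs = solve-∀
  rhs : ∀ u w → 4 * (u * (w * w)) ≡ 4 * u * (w * w)
  rhs = solve-∀

3≤n≤4⇒n≡3⊎n≡4 : ∀ {n} → 3 ≤ n → n ≤ 4 → n ≡ 3 ⊎ n ≡ 4
3≤n≤4⇒n≡3⊎n≡4 {1} (s≤s ()) _
3≤n≤4⇒n≡3⊎n≡4 {2} (s≤s (s≤s ())) _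
3≤n≤4⇒n≡3⊎n≡4 {3} _ _ = inj₁ refl
3≤n≤4⇒n≡3⊎n≡4 {4} _ _ = inj₂ refl
3≤n≤4⇒n≡3⊎n≡4 {suc (suc (suc (suc (suc _))))} _ (s≤s (s≤s (s≤s (s≤s ()))))

distinct-triple⇒3≤n : ∀ {n} {a b c : Fin n} → a ≢ b → a ≢ c → b ≢ c → 3 ≤ n
distinct-triple⇒3≤n {suc (suc (suc _))} _ _ _ = s≤s (s≤s (s≤s z≤n))
distinct-triple⇒3≤n {1} {zero} {zero} a≢b _ _ = ⊥-elim (a≢b refl)
distinct-triple⇒3≤n {2} {zero}     {zero}     a≢b _   _   = ⊥-elim (a≢b refl)
distinct-triple⇒3≤n {2} {suc zero} {suc zero} a≢b _   _   = ⊥-elim (a≢b refl)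
distinct-triple⇒3≤n {2} {zero}     {suc zero} {zero}     _ a≢c _   = ⊥-elim (a≢c refl)
distinct-triple⇒3≤n {2} {suc zero} {zero}     {suc zero} _ a≢c _   = ⊥-elim (a≢c refl)
distinct-triple⇒3≤n {2} {zero}     {suc zero} {suc zero} _ _   b≢c = ⊥-elim (b≢c refl)
distinct-triple⇒3≤n {2} {suc zero} {zero}     {zero}     _ _   b≢c = ⊥-elim (b≢c refl)

pairSum : ∀ {a} {X : Set a} → (X → X → ℕ) → X × X × X → ℕ
pairSum g (a , b , c) = g a b + g a c + g b a + g b c + g c a + g c b

sameColour differentColour : ∀ {c} → Fin c → Fin c → ℕ
sameColour      α β = 𝟙 (α ≟ β)
differentColour α β = 𝟙 (¬? (α ≟ β))

pairSum-different≡2*pairSum-same : ∀ (α β γ : Fin 2) → ¬ (α ≡ β × β ≡ γ) →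
  pairSum differentColour (α , β , γ) ≡ 2 * pairSum sameColour (α , β , γ)
pairSum-different≡2*pairSum-same zero       zero       zero       mono = ⊥-elim (mono (refl , refl))
pairSum-different≡2*pairSum-same zero       zero       (suc zero) _    = refl
pairSum-different≡2*pairSum-same zero       (suc zero) zero       _    = refl
pairSum-different≡2*pairSum-same zero       (suc zero) (suc zero) _    = refl
pairSum-different≡2*pairSum-same (suc zero) zero       zero       _    = refl
pairSum-different≡2*pairSum-same (suc zero) zero       (suc zero) _    = refl
pairSum-different≡2*pairSum-same (suc zero) (suc zero) zero       _    = refl
pairSum-different≡2*pairSum-same (suc zero) (suc zero) (suc zero) mono = ⊥-elim (mono (refl , refl))

sameColour-classes : ∀ (α : Fin 2) → sameColour α 0F + sameColour α 1F ≡ 1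
sameColour-classes zero       = refl
sameColour-classes (suc zero) = refl

sameColour-by-classes : ∀ (α β : Fin 2) →
  sameColour α β ≡ sameColour α 0F * sameColour β 0F + sameColour α 1F * sameColour β 1F
sameColour-by-classes zero       zero       = refl
sameColour-by-classes zero       (suc zero) = refl
sameColour-by-classes (suc zero) zero       = refl
sameColour-by-classes (suc zero) (suc zero) = refl

differentColour-by-classes : ∀ (α β : Fin 2) →
  differentColour α β ≡ sameColour α 0F * sameColour β 1F + sameColour α 1F * sameColour β 0F
differentColour-by-classes zero       zero       = refl
differentColour-by-classes zero       (suc zero) = refl
differentColour-by-classes (suc zero) zero       = refl
differentColour-by-classes (suc zero) (suc zero) = refl

module _ {u w : ℕ} where

  ∑P : (Point u w → ℕ) → ℕ
  ∑P h = ∑[ i < u ] ∑[ j < w ] h (i , j)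

  ∑P-cong : {f g : Point u w → ℕ} → (∀ x → f x ≡ g x) → ∑P f ≡ ∑P g
  ∑P-cong f≡g = sum-cong-≗ (λ i → sum-cong-≗ (λ j → f≡g (i , j)))

  ∑P-distrib-+ : (f g : Point u w → ℕ) → ∑P (λ x → f x + g x) ≡ ∑P f + ∑P g
  ∑P-distrib-+ f g = trans (sum-cong-≗ (λ i → ∑-distrib-+ (λ j → f (i , j)) (λ j → g (i , j))))
                           (∑-distrib-+ (λ i → ∑[ j < w ] f (i , j)) (λ i → ∑[ j < w ] g (i , j)))

  *-distribˡ-∑P : ∀ c (f : Point u w → ℕ) → c * ∑P f ≡ ∑P (λ x → c * f x)
  *-distribˡ-∑P c f = trans (*-distribˡ-sum c (λ i → ∑[ j < w ] f (i , j)))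
                            (sum-cong-≗ (λ i → *-distribˡ-sum c (λ j → f (i , j))))

  *-distribʳ-∑P : ∀ c (f : Point u w → ℕ) → ∑P f * c ≡ ∑P (λ x → f x * c)
  *-distribʳ-∑P c f = trans (*-distribʳ-sum c (λ i → ∑[ j < w ] f (i , j)))
                            (sum-cong-≗ (λ i → *-distribʳ-sum c (λ j → f (i , j))))

  ∑P-comm : ∀ n (F : Point u w → Fin n → ℕ) →
            ∑P (λ x → ∑[ k < n ] F x k) ≡ ∑[ k < n ] ∑P (λ x → F x k)
  ∑P-comm n F = begin
    ∑[ i < u ] ∑[ j < w ] ∑[ k < n ] F (i , j) k  ≡⟨ sum-cong-≗ (λ i → ∑-comm (λ j k → F (i , j) k)) ⟩
    ∑[ i < u ] ∑[ k < n ] ∑[ j < w ] F (i , j) k  ≡⟨ ∑-comm (λ i k → ∑[ j < w ] F (i , j) k) ⟩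
    ∑[ k < n ] ∑[ i < u ] ∑[ j < w ] F (i , j) k  ∎
    where open ≡-Reasoning

  ∑P-const : ∀ c → ∑P (λ _ → c) ≡ u * (w * c)
  ∑P-const c = begin
    ∑[ i < u ] ∑[ j < w ] c  ≡⟨ sum-cong-≗ {u} (λ i → ∑-const w c) ⟩
    ∑[ i < u ] (w * c)       ≡⟨ ∑-const u (w * c) ⟩
    u * (w * c)              ∎
    where open ≡-Reasoning

  ∑P-single : {f : Point u w → ℕ} (a : Point u w) → (∀ x → x ≢ a → f x ≡ 0) → ∑P f ≡ f a
  ∑P-single {f} (k , l) f≡0 = trans
    (∑-single {f = λ i → ∑[ j < w ] f (i , j)} k (λ i i≢k → ∑-zero w (λ j → f≡0 (i , j) (i≢k ∘ cong proj₁))))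
    (∑-single l (λ j j≢l → f≡0 (k , j) (j≢l ∘ cong proj₂)))

  _≟P_ : DecidableEquality (Point u w)
  _≟P_ = ≡-dec _≟_ _≟_

  ∑P-sift : (a : Point u w) (h : Point u w → ℕ) → ∑P (λ x → 𝟙 (x ≟P a) * h x) ≡ h a
  ∑P-sift a h = trans (∑P-single a (λ x x≢a → cong (_* h x) (𝟙-no (x ≟P a) x≢a)))
                      (trans (cong (_* h a) (𝟙-yes (a ≟P a) refl)) (*-identityˡ (h a)))

  ∑Pairs : (Point u w → Point u w → ℕ) → ℕ
  ∑Pairs g = ∑P (λ x → ∑P (λ y → g x y))

  ∑Pairs-cong : {f g : Point u w → Point u w → ℕ} → (∀ x y → f x y ≡ g x y) → ∑Pairs f ≡ ∑Pairs g
  ∑Pairs-cong f≡g = ∑P-cong (λ x → ∑P-cong (f≡g x))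

  ∑Pairs-distrib-+ : (f g : Point u w → Point u w → ℕ) →
                     ∑Pairs (λ x y → f x y + g x y) ≡ ∑Pairs f + ∑Pairs g
  ∑Pairs-distrib-+ f g = trans (∑P-cong (λ x → ∑P-distrib-+ (f x) (g x))) (∑P-distrib-+ _ _)

  ∑Pairs-product : (p q : Point u w → ℕ) → ∑Pairs (λ x y → p x * q y) ≡ ∑P p * ∑P q
  ∑Pairs-product p q = begin
    ∑P (λ x → ∑P (λ y → p x * q y))  ≡⟨ ∑P-cong (λ x → *-distribˡ-∑P (p x) q) ⟨
    ∑P (λ x → p x * ∑P q)            ≡⟨ *-distribʳ-∑P (∑P q) p ⟨
    ∑P p * ∑P q                      ∎
    where open ≡-Reasoning

  ∑Pairs-split : ∀ {ℓ} {_~_ : Point u w → Point u w → Set ℓ} (R : ∀ x y → Dec (x ~ y))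
                 (g : Point u w → Point u w → ℕ) →
                 ∑Pairs g ≡ ∑Pairs (λ x y → 𝟙 (¬? (R x y)) * g x y) + ∑Pairs (λ x y → 𝟙 (R x y) * g x y)
  ∑Pairs-split R g = trans (∑Pairs-cong split) (∑Pairs-distrib-+ _ _)
    where
    split : ∀ x y → g x y ≡ 𝟙 (¬? (R x y)) * g x y + 𝟙 (R x y) * g x y
    split x y = begin
      g x y                                  ≡⟨ *-identityˡ (g x y) ⟨
      1 * g x y                              ≡⟨ cong (_* g x y) (𝟙-¬?+𝟙 (R x y)) ⟨
      (𝟙 (¬? (R x y)) + 𝟙 (R x y)) * g x y  ≡⟨ *-distribʳ-+ (g x y) (𝟙 (¬? (R x y))) (𝟙 (R x y)) ⟩
      𝟙 (¬? (R x y)) * g x y + 𝟙 (R x y) * g x y ∎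
      where open ≡-Reasoning

  occurrences : Point u w → Block u w → ℕ
  occurrences x (a , b , c) = 𝟙 (x ≟P a) + 𝟙 (x ≟P b) + 𝟙 (x ≟P c)

  _∈B?_ : (x : Point u w) (B : Block u w) → Dec (x ∈B B)
  x ∈B? (a , b , c) = x ≟P a ⊎-dec x ≟P b ⊎-dec x ≟P c

  occurrences-∉ : ∀ {x} B → ¬ x ∈B B → occurrences x B ≡ 0
  occurrences-∉ {x} (a , b , c) x∉B = cong₂ _+_
    (cong₂ _+_ (𝟙-no (x ≟P a) (x∉B ∘ inj₁)) (𝟙-no (x ≟P b) (x∉B ∘ inj₂ ∘ inj₁)))
    (𝟙-no (x ≟P c) (x∉B ∘ inj₂ ∘ inj₂))

  occurrences-∈ : ∀ {x} B → DistinctBlock B → x ∈B B → occurrences x B ≡ 1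
  occurrences-∈ (a , b , c) (a≢b , a≢c , b≢c) (inj₁ refl) = cong₂ _+_
    (cong₂ _+_ (𝟙-yes (a ≟P a) refl) (𝟙-no (a ≟P b) a≢b)) (𝟙-no (a ≟P c) a≢c)
  occurrences-∈ (a , b , c) (a≢b , a≢c , b≢c) (inj₂ (inj₁ refl)) = cong₂ _+_
    (cong₂ _+_ (𝟙-no (b ≟P a) (a≢b ∘ sym)) (𝟙-yes (b ≟P b) refl)) (𝟙-no (b ≟P c) b≢c)
  occurrences-∈ (a , b , c) (a≢b , a≢c , b≢c) (inj₂ (inj₂ refl)) = cong₂ _+_
    (cong₂ _+_ (𝟙-no (c ≟P a) (a≢c ∘ sym)) (𝟙-no (c ≟P b) (b≢c ∘ sym))) (𝟙-yes (c ≟P c) refl)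

  occurrences-pair-∈ : ∀ {x y} B → DistinctBlock B → x ∈B B × y ∈B B →
                       occurrences x B * occurrences y B ≡ 1
  occurrences-pair-∈ B dB (x∈B , y∈B) = cong₂ _*_ (occurrences-∈ B dB x∈B) (occurrences-∈ B dB y∈B)

  occurrences-pair-∉ : ∀ {x y} B → ¬ (x ∈B B × y ∈B B) → occurrences x B * occurrences y B ≡ 0
  occurrences-pair-∉ {x} {y} B x,y∉B with x ∈B? B
  ... | yes x∈B = trans (cong (occurrences x B *_) (occurrences-∉ B (λ y∈B → x,y∉B (x∈B , y∈B))))
                        (*-zeroʳ (occurrences x B))
  ... | no x∉B  = cong (_* occurrences y B) (occurrences-∉ B x∉B)

  ∑P-occurrences : (a b c : Point u w) (h : Point u w → ℕ) →
                   ∑P (λ x → occurrences x (a , b , c) * h x) ≡ h a + h b + h c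
  ∑P-occurrences a b c h = begin
    ∑P (λ x → occurrences x (a , b , c) * h x)                          ≡⟨ ∑P-cong distrib ⟩
    ∑P (λ x → 𝟙 (x ≟P a) * h x + 𝟙 (x ≟P b) * h x + 𝟙 (x ≟P c) * h x)  ≡⟨ ∑P-distrib-+ _ _ ⟩
    ∑P (λ x → 𝟙 (x ≟P a) * h x + 𝟙 (x ≟P b) * h x) + ∑P (λ x → 𝟙 (x ≟P c) * h x)
      ≡⟨ cong (_+ ∑P (λ x → 𝟙 (x ≟P c) * h x)) (∑P-distrib-+ _ _) ⟩
    ∑P (λ x → 𝟙 (x ≟P a) * h x) + ∑P (λ x → 𝟙 (x ≟P b) * h x) + ∑P (λ x → 𝟙 (x ≟P c) * h x)
      ≡⟨ cong₂ _+_ (cong₂ _+_ (∑P-sift a h) (∑P-sift b h)) (∑P-sift c h) ⟩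
    h a + h b + h c                                                     ∎
    where
    open ≡-Reasoning
    distrib : ∀ x → occurrences x (a , b , c) * h x ≡ 𝟙 (x ≟P a) * h x + 𝟙 (x ≟P b) * h x + 𝟙 (x ≟P c) * h x
    distrib x = trans (*-distribʳ-+ (h x) (𝟙 (x ≟P a) + 𝟙 (x ≟P b)) (𝟙 (x ≟P c)))
                      (cong (_+ 𝟙 (x ≟P c) * h x) (*-distribʳ-+ (h x) (𝟙 (x ≟P a)) (𝟙 (x ≟P b))))

  ∑Pairs-occurrences : (a b c : Point u w) (h : Point u w → Point u w → ℕ) →
    ∑Pairs (λ x y → occurrences x (a , b , c) * occurrences y (a , b , c) * h x y) ≡
    (h a a + h a b + h a c) + (h b a + h b b + h b c) + (h c a + h c b + h c c)
  ∑Pairs-occurrences a b c h = begin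
    ∑P (λ x → ∑P (λ y → occurrences x B * occurrences y B * h x y))
      ≡⟨ ∑P-cong (λ x → ∑P-cong (λ y → *-assoc (occurrences x B) (occurrences y B) (h x y))) ⟩
    ∑P (λ x → ∑P (λ y → occurrences x B * (occurrences y B * h x y)))
      ≡⟨ ∑P-cong (λ x → *-distribˡ-∑P (occurrences x B) (λ y → occurrences y B * h x y)) ⟨
    ∑P (λ x → occurrences x B * ∑P (λ y → occurrences y B * h x y))
      ≡⟨ ∑P-cong (λ x → cong (occurrences x B *_) (∑P-occurrences a b c (h x))) ⟩
    ∑P (λ x → occurrences x B * (h x a + h x b + h x c))
      ≡⟨ ∑P-occurrences a b c (λ x → h x a + h x b + h x c) ⟩
    (h a a + h a b + h a c) + (h b a + h b b + h b c) + (h c a + h c b + h c c) ∎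
    where
    open ≡-Reasoning
    B : Block u w
    B = a , b , c

  offDiagonal : (Point u w → Point u w → ℕ) → Point u w → Point u w → ℕ
  offDiagonal g x y = 𝟙 (¬? (x ≟P y)) * g x y

  ∑Pairs-block : (g : Point u w → Point u w → ℕ) (B : Block u w) → DistinctBlock B →
                 ∑Pairs (λ x y → occurrences x B * occurrences y B * offDiagonal g x y) ≡ pairSum g B
  ∑Pairs-block g (a , b , c) (a≢b , a≢c , b≢c) = begin
    ∑Pairs (λ x y → occurrences x B * occurrences y B * offDiagonal g x y)
      ≡⟨ ∑Pairs-occurrences a b c (offDiagonal g) ⟩
    (g₀ a a + g₀ a b + g₀ a c) + (g₀ b a + g₀ b b + g₀ b c) + (g₀ c a + g₀ c b + g₀ c c)
      ≡⟨ cong₂ _+_ (cong₂ _+_ (cong₂ _+_ (cong₂ _+_ (diagonal a) (off a≢b)) (off a≢c))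
                             (cong₂ _+_ (cong₂ _+_ (off (a≢b ∘ sym)) (diagonal b)) (off b≢c)))
                   (cong₂ _+_ (cong₂ _+_ (off (a≢c ∘ sym)) (off (b≢c ∘ sym))) (diagonal c)) ⟩
    (0 + g a b + g a c) + (g b a + 0 + g b c) + (g c a + g c b + 0)
      ≡⟨ rearrange (g a b) (g a c) (g b a) (g b c) (g c a) (g c b) ⟩
    pairSum g B ∎
    where
    open ≡-Reasoning
    B : Block u w
    B = a , b , c
    g₀ : Point u w → Point u w → ℕ
    g₀ = offDiagonal g
    diagonal : ∀ x → g₀ x x ≡ 0
    diagonal x = cong (_* g x x) (𝟙-no (¬? (x ≟P x)) (λ x≢x → x≢x refl))
    off : ∀ {x y} → x ≢ y → g₀ x y ≡ g x y
    off {x} {y} x≢y = trans (cong (_* g x y) (𝟙-yes (¬? (x ≟P y)) x≢y)) (*-identityˡ (g x y))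
    rearrange : ∀ p q r s t v → (0 + p + q) + (r + 0 + s) + (t + v + 0) ≡ p + q + r + s + t + v
    rearrange = solve-∀

  sameGroup crossGroup : Point u w → Point u w → ℕ
  sameGroup  x y = 𝟙 (group x ≟ group y)
  crossGroup x y = 𝟙 (¬? (group x ≟ group y))

  ∑Pairs-sameGroup : ∑Pairs sameGroup ≡ u * (w * w)
  ∑Pairs-sameGroup = trans (∑P-cong groupSize) (∑P-const w)
    where
    open ≡-Reasoning
    groupSize : ∀ x → ∑P (sameGroup x) ≡ w
    groupSize x = begin
      ∑[ i < u ] ∑[ j < w ] 𝟙 (group x ≟ i)
        ≡⟨ ∑-single (group x) (λ i i≢gx → ∑-zero w (λ j → 𝟙-no (group x ≟ i) (i≢gx ∘ sym))) ⟩
      ∑[ j < w ] 𝟙 (group x ≟ group x)  ≡⟨ ∑-const w _ ⟩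
      w * 𝟙 (group x ≟ group x)         ≡⟨ cong (w *_) (𝟙-yes (group x ≟ group x) refl) ⟩
      w * 1                             ≡⟨ *-identityʳ w ⟩
      w                                 ∎

  module _ (D : GDD3 u w) where

    block : Fin (length (blocks D)) → Block u w
    block = lookup (blocks D)

    block-distinct : ∀ i → DistinctBlock (block i)
    block-distinct i = All.lookup (size3 D) (∈-lookup i)

    block⇒3≤u : Fin (length (blocks D)) → 3 ≤ u
    block⇒3≤u i with block-distinct i
    ... | a≢b , a≢c , b≢c = distinct-triple⇒3≤n
      (λ ga≡gb → inGroup D _ _ a≢b ga≡gb i (inj₁ refl , inj₂ (inj₁ refl)))
      (λ ga≡gc → inGroup D _ _ a≢c ga≡gc i (inj₁ refl , inj₂ (inj₂ refl)))
      (λ gb≡gc → inGroup D _ _ b≢c gb≡gc i (inj₂ (inj₁ refl) , inj₂ (inj₂ refl)))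

    ∑-blocksThrough : ∀ {x y} → x ≢ y →
      ∑[ i < length (blocks D) ] (occurrences x (block i) * occurrences y (block i)) ≡ crossGroup x y
    ∑-blocksThrough {x} {y} x≢y with group x ≟ group y
    ... | yes same = ∑-zero _ (λ i → occurrences-pair-∉ (block i) (inGroup D x y x≢y same i))
    ... | no cross with outGroup D x y cross
    ...   | i₀ , x,y∈Bᵢ₀ , unique =
      trans (∑-single i₀ (λ i i≢i₀ → occurrences-pair-∉ (block i) (i≢i₀ ∘ unique i)))
            (occurrences-pair-∈ (block i₀) (block-distinct i₀) x,y∈Bᵢ₀)

    -- For x = y the block sum would count the blocks through x, hence `offDiagonal`.
    crossGroup-by-blocks : (g : Point u w → Point u w → ℕ) (x y : Point u w) →
      crossGroup x y * g x y ≡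
      ∑[ i < length (blocks D) ] (occurrences x (block i) * occurrences y (block i) * offDiagonal g x y)
    crossGroup-by-blocks g x y with x ≟P y
    ... | yes refl = trans (cong (_* g x x) (𝟙-no (¬? (group x ≟ group x)) (λ x≁x → x≁x refl)))
                           (sym (∑-zero _ (λ i → *-zeroʳ (occurrences x (block i) * occurrences x (block i)))))
    ... | no x≢y = begin
      crossGroup x y * g x y
        ≡⟨ cong (_* g x y) (∑-blocksThrough x≢y) ⟨
      (∑[ i < length (blocks D) ] (occ i x * occ i y)) * g x y
        ≡⟨ *-distribʳ-sum (g x y) (λ i → occ i x * occ i y) ⟩
      ∑[ i < length (blocks D) ] (occ i x * occ i y * g x y)
        ≡⟨ sum-cong-≗ (λ i → cong (occ i x * occ i y *_) (*-identityˡ (g x y))) ⟨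
      ∑[ i < length (blocks D) ] (occ i x * occ i y * (1 * g x y)) ∎
      where
      open ≡-Reasoning
      occ : Fin (length (blocks D)) → Point u w → ℕ
      occ i z = occurrences z (block i)

    ∑Pairs-crossGroup : (g : Point u w → Point u w → ℕ) →
      ∑Pairs (λ x y → crossGroup x y * g x y) ≡ ∑[ i < length (blocks D) ] pairSum g (block i)
    ∑Pairs-crossGroup g = begin
      ∑Pairs (λ x y → crossGroup x y * g x y)  ≡⟨ ∑Pairs-cong (crossGroup-by-blocks g) ⟩
      ∑P (λ x → ∑P (λ y → ∑[ i < n ] T i x y))  ≡⟨ ∑P-cong (λ x → ∑P-comm n (λ y i → T i x y)) ⟩
      ∑P (λ x → ∑[ i < n ] ∑P (λ y → T i x y))  ≡⟨ ∑P-comm n (λ x i → ∑P (T i x)) ⟩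
      ∑[ i < n ] ∑Pairs (T i)                   ≡⟨ sum-cong-≗ (λ i → ∑Pairs-block g (block i) (block-distinct i)) ⟩
      ∑[ i < n ] pairSum g (block i)            ∎
      where
      open ≡-Reasoning
      n : ℕ
      n = length (blocks D)
      T : Fin n → Point u w → Point u w → ℕ
      T i x y = occurrences x (block i) * occurrences y (block i) * offDiagonal g x y

  module _ (D : GDD3 u w) (f : Point u w → Fin 2) (f-weak : WeakColouring D 2 f) where

    monochromatic bichromatic : Point u w → Point u w → ℕ
    monochromatic x y = sameColour (f x) (f y)
    bichromatic   x y = differentColour (f x) (f y)

    classSize : Fin 2 → ℕ
    classSize α = ∑P (λ x → sameColour (f x) α)

    classSize-total : classSize 0F + classSize 1F ≡ u * w
    classSize-total = begin
      classSize 0F + classSize 1F                         ≡⟨ ∑P-distrib-+ (λ x → sameColour (f x) 0F) _ ⟨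
      ∑P (λ x → sameColour (f x) 0F + sameColour (f x) 1F) ≡⟨ ∑P-cong (λ x → sameColour-classes (f x)) ⟩
      ∑P (λ _ → 1)                                        ≡⟨ ∑P-const 1 ⟩
      u * (w * 1)                                         ≡⟨ cong (u *_) (*-identityʳ w) ⟩
      u * w                                               ∎
      where open ≡-Reasoning

    ∑Pairs-monochromatic : ∑Pairs monochromatic ≡ classSize 0F * classSize 0F + classSize 1F * classSize 1F
    ∑Pairs-monochromatic = begin
      ∑Pairs monochromatic
        ≡⟨ ∑Pairs-cong (λ x y → sameColour-by-classes (f x) (f y)) ⟩
      ∑Pairs (λ x y → sameColour (f x) 0F * sameColour (f y) 0F + sameColour (f x) 1F * sameColour (f y) 1F)
        ≡⟨ ∑Pairs-distrib-+ _ _ ⟩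
      ∑Pairs (λ x y → sameColour (f x) 0F * sameColour (f y) 0F) + ∑Pairs (λ x y → sameColour (f x) 1F * sameColour (f y) 1F)
        ≡⟨ cong₂ _+_ (∑Pairs-product _ _) (∑Pairs-product _ _) ⟩
      classSize 0F * classSize 0F + classSize 1F * classSize 1F ∎
      where open ≡-Reasoning

    ∑Pairs-bichromatic : ∑Pairs bichromatic ≡ classSize 0F * classSize 1F + classSize 1F * classSize 0F
    ∑Pairs-bichromatic = begin
      ∑Pairs bichromatic
        ≡⟨ ∑Pairs-cong (λ x y → differentColour-by-classes (f x) (f y)) ⟩
      ∑Pairs (λ x y → sameColour (f x) 0F * sameColour (f y) 1F + sameColour (f x) 1F * sameColour (f y) 0F)
        ≡⟨ ∑Pairs-distrib-+ _ _ ⟩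
      ∑Pairs (λ x y → sameColour (f x) 0F * sameColour (f y) 1F) + ∑Pairs (λ x y → sameColour (f x) 1F * sameColour (f y) 0F)
        ≡⟨ cong₂ _+_ (∑Pairs-product _ _) (∑Pairs-product _ _) ⟩
      classSize 0F * classSize 1F + classSize 1F * classSize 0F ∎
      where open ≡-Reasoning

    ∑Pairs-bichromatic≤monochromatic : ∑Pairs bichromatic ≤ ∑Pairs monochromatic
    ∑Pairs-bichromatic≤monochromatic = subst₂ _≤_ (sym ∑Pairs-bichromatic) (sym ∑Pairs-monochromatic)
                                               (m*n+n*m≤m*m+n*n (classSize 0F) (classSize 1F))

    ∑Pairs-all : ∑Pairs monochromatic + ∑Pairs bichromatic ≡ (u * w) * (u * w)
    ∑Pairs-all = begin
      ∑Pairs monochromatic + ∑Pairs bichromatic  ≡⟨ cong₂ _+_ ∑Pairs-monochromatic ∑Pairs-bichromatic ⟩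
      (r * r + b * b) + (r * b + b * r)          ≡⟨ square-of-sum r b ⟩
      (r + b) * (r + b)                          ≡⟨ cong (λ n → n * n) classSize-total ⟩
      (u * w) * (u * w)                          ∎
      where
      open ≡-Reasoning
      r b : ℕ
      r = classSize 0F
      b = classSize 1F
      square-of-sum : ∀ r b → (r * r + b * b) + (r * b + b * r) ≡ (r + b) * (r + b)
      square-of-sum = solve-∀

    ∑Pairs-crossGroup-bichromatic :
      ∑Pairs (λ x y → crossGroup x y * bichromatic x y) ≡ 2 * ∑Pairs (λ x y → crossGroup x y * monochromatic x y)
    ∑Pairs-crossGroup-bichromatic = begin
      ∑Pairs (λ x y → crossGroup x y * bichromatic x y)
        ≡⟨ ∑Pairs-crossGroup D bichromatic ⟩
      ∑[ i < n ] pairSum bichromatic (block D i)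
        ≡⟨ sum-cong-≗ {n} (λ i → pairSum-different≡2*pairSum-same _ _ _ (All.lookup f-weak (∈-lookup i))) ⟩
      ∑[ i < n ] (2 * pairSum monochromatic (block D i))
        ≡⟨ *-distribˡ-sum 2 (λ i → pairSum monochromatic (block D i)) ⟨
      2 * ∑[ i < n ] pairSum monochromatic (block D i)
        ≡⟨ cong (2 *_) (∑Pairs-crossGroup D monochromatic) ⟨
      2 * ∑Pairs (λ x y → crossGroup x y * monochromatic x y) ∎
      where
      open ≡-Reasoning
      n : ℕ
      n = length (blocks D)

    ∑Pairs-sameGroup-colours :
      ∑Pairs (λ x y → sameGroup x y * monochromatic x y) + ∑Pairs (λ x y → sameGroup x y * bichromatic x y) ≡
      u * (w * w)
    ∑Pairs-sameGroup-colours = trans (sym (∑Pairs-distrib-+ _ _)) (trans (∑Pairs-cong split) ∑Pairs-sameGroup)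
      where
      split : ∀ x y → sameGroup x y * monochromatic x y + sameGroup x y * bichromatic x y ≡ sameGroup x y
      split x y = begin
        sameGroup x y * monochromatic x y + sameGroup x y * bichromatic x y
          ≡⟨ *-distribˡ-+ (sameGroup x y) (monochromatic x y) (bichromatic x y) ⟨
        sameGroup x y * (monochromatic x y + bichromatic x y)
          ≡⟨ cong (sameGroup x y *_) (trans (+-comm (monochromatic x y) _) (𝟙-¬?+𝟙 (f x ≟ f y))) ⟩
        sameGroup x y * 1
          ≡⟨ *-identityʳ (sameGroup x y) ⟩
        sameGroup x y ∎
        where open ≡-Reasoning

    weakColouring-2⇒pair-bound : (u * w) * (u * w) ≤ 4 * (u * (w * w))
    weakColouring-2⇒pair-bound =
      subst₂ _≤_ all-pairs (cong (4 *_) ∑Pairs-sameGroup-colours)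
             (pair-count-bound crossMono sameMono sameBi
               (subst₂ _≤_ bichromatic-split monochromatic-split ∑Pairs-bichromatic≤monochromatic))
      where
      crossMono sameMono sameBi : ℕ
      crossMono = ∑Pairs (λ x y → crossGroup x y * monochromatic x y)
      sameMono  = ∑Pairs (λ x y → sameGroup x y * monochromatic x y)
      sameBi    = ∑Pairs (λ x y → sameGroup x y * bichromatic x y)
      monochromatic-split : ∑Pairs monochromatic ≡ crossMono + sameMono
      monochromatic-split = ∑Pairs-split (λ x y → group x ≟ group y) monochromatic
      bichromatic-split : ∑Pairs bichromatic ≡ 2 * crossMono + sameBi
      bichromatic-split = trans (∑Pairs-split (λ x y → group x ≟ group y) bichromatic)
                                (cong (_+ sameBi) ∑Pairs-crossGroup-bichromatic)
      all-pairs : (crossMono + sameMono) + (2 * crossMono + sameBi) ≡ (u * w) * (u * w)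
      all-pairs = trans (cong₂ _+_ (sym monochromatic-split) (sym bichromatic-split)) ∑Pairs-all

weakChromaticNumber-2⇒block : ∀ {u w} (D : GDD3 u w) → WeakChromaticNumber D 2 → Fin (length (blocks D))
weakChromaticNumber-2⇒block D (_ , minimal) with blocks D | minimal 1 (s≤s (s≤s z≤n))
... | []    | not-1-colourable = ⊥-elim (not-1-colourable ((λ _ → zero) , []))
... | _ ∷ _ | _                = zero

corollary3p2 : (u w : ℕ) (D : GDD3 u w) → WeakChromaticNumber D 2 → u ≡ 3 ⊎ u ≡ 4
corollary3p2 u w D χ@((f , f-weak) , _) = 3≤n≤4⇒n≡3⊎n≡4 (block⇒3≤u D i) u≤4
  where
  i : Fin (length (blocks D))
  i = weakChromaticNumber-2⇒block D χ
  instance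
    w≢0 : NonZero w
    w≢0 = nonZeroIndex (proj₂ (proj₁ (block D i)))
  u≤4 : u ≤ 4
  u≤4 = u²w²≤4uw²⇒u≤4 u w (weakColouring-2⇒pair-bound D f f-weak)
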